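{- Let $A=\{a_0<a_1<a_2<a_3\}$ be a set of integers and $\mathbf{r}=(r_0,r_1,r_2,r_3)$ an ordered $4$-tuple of positive integers. Suppose $h$ is an integer with $2\le h\le r_0+r_1+r_2+r_3-2$. Then: (i) if $r_1=r_2=1$, then $|h^{(\mathbf{r})}A|=L(\mathbf{r},h)$ if and only if $a_1-a_0=a_3-a_2$; (ii) if $r_1\ge 2$ or $r_2\ge 2$, then $|h^{(\mathbf{r})}A|=L(\mathbf{r},h)$ if and only if $A$ is a $4$-term arithmetic progression.
   Context: Here $k=4$. Define $$h^{(\mathbf{r})}A=\Big\{\sum_{i=0}^{k-1}s_ia_i:\ s_i\in\mathbb{Z},\ 0\le s_i\le r_i,\ \sum_{i=0}^{k-1}s_i=h\Big\}.$$ Empty sums are $0$. Let $I_{\mathbf{r}}(h)$ be the largest integer (with $0\le I_{\mathbf{r}}(h)\le k$) such that $\sum_{j=0}^{I_{\mathbf{r}}(h)-1}r_j\le h$, and $M_{\mathbf{r}}(h)$ the least integer (with $-1\le M_{\mathbf{r}}(h)\le k-1$) such that $\sum_{j=M_{\mathbf{r}}(h)+1}^{k-1}r_j\le h$. Put $\delta_{\mathbf{r}}(h)=h-\sum_{j=0}^{I_{\mathbf{r}}(h)-1}r_j$, $\theta_{\mathbf{r}}(h)=h-\sum_{j=M_{\mathbf{r}}(h)+1}^{k-1}r_j$, and $$L(\mathbf{r},h)=\sum_{j=M_{\mathbf{r}}(h)+1}^{k-1}j r_j-\sum_{j=0}^{I_{\mathbf{r}}(h)-1}j r_j+M_{\mathbf{r}}(h)\,\theta_{\mathbf{r}}(h)-I_{\mathbf{r}}(h)\,\delta_{\mathbf{r}}(h)+1.$$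 -}

module Defs where

open import Data.Nat as ℕ using (ℕ; zero; suc; _≤?_)
open import Data.Integer as ℤ using (ℤ; +_; _-_; _*_; _+_)
open import Data.List using (List; []; _∷_; concatMap; map; length; upTo; filter; deduplicate)
open import Data.Product using (_×_; _,_)
open import Relation.Nullary using (yes; no)

range : ℕ → List ℕ
range r = upTo (suc r)

tuples : (r0 r1 r2 r3 h : ℕ) → List (ℕ × ℕ × ℕ × ℕ)
tuples r0 r1 r2 r3 h =
  filter (λ { (s0 , s1 , s2 , s3) → (s0 ℕ.+ s1 ℕ.+ s2 ℕ.+ s3) ℕ.≟ h })
    (concatMap (λ s0 → concatMap (λ s1 → concatMap (λ s2 → map (λ s3 → (s0 , s1 , s2 , s3))
      (range r3)) (range r2)) (range r1)) (range r0))

restrictedSumList : (a0 a1 a2 a3 : ℤ) (r0 r1 r2 r3 h : ℕ) → List ℤ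
restrictedSumList a0 a1 a2 a3 r0 r1 r2 r3 h =
  map (λ { (s0 , s1 , s2 , s3) → + s0 * a0 + + s1 * a1 + + s2 * a2 + + s3 * a3 })
    (tuples r0 r1 r2 r3 h)

card-hrA : (a0 a1 a2 a3 : ℤ) (r0 r1 r2 r3 h : ℕ) → ℕ
card-hrA a0 a1 a2 a3 r0 r1 r2 r3 h =
  length (deduplicate ℤ._≟_ (restrictedSumList a0 a1 a2 a3 r0 r1 r2 r3 h))

-- I_r(h): largest i ∈ {0..4} with r0+...+r_{i-1} ≤ h (prefix sums are monotone)
Iᵣ : (r0 r1 r2 r3 h : ℕ) → ℕ
Iᵣ r0 r1 r2 r3 h with r0 ℕ.+ r1 ℕ.+ r2 ℕ.+ r3 ≤? h
... | yes _ = 4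
... | no _ with r0 ℕ.+ r1 ℕ.+ r2 ≤? h
...   | yes _ = 3
...   | no _ with r0 ℕ.+ r1 ≤? h
...     | yes _ = 2
...     | no _ with r0 ≤? h
...       | yes _ = 1
...       | no _ = 0

-- M_r(h) + 1: least j ∈ {0..4} with r_j+...+r_3 ≤ h (suffix sums are antitone)
Mᵣ+1 : (r0 r1 r2 r3 h : ℕ) → ℕ
Mᵣ+1 r0 r1 r2 r3 h with r0 ℕ.+ r1 ℕ.+ r2 ℕ.+ r3 ≤? h
... | yes _ = 0
... | no _ with r1 ℕ.+ r2 ℕ.+ r3 ≤? h
...   | yes _ = 1
...   | no _ with r2 ℕ.+ r3 ≤? h
...     | yes _ = 2
...     | no _ with r3 ≤? h
...       | yes _ = 3
...       | no _ = 4

Mᵣ : (r0 r1 r2 r3 h : ℕ) → ℤ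
Mᵣ r0 r1 r2 r3 h = + Mᵣ+1 r0 r1 r2 r3 h - + 1

rs : (r0 r1 r2 r3 : ℕ) → List ℕ
rs r0 r1 r2 r3 = r0 ∷ r1 ∷ r2 ∷ r3 ∷ []

-- Σ_{lo ≤ j < hi} f j r_j  over j ∈ {0,1,2,3}
sumRange : (ℕ → ℕ → ℤ) → ℕ → ℕ → List ℕ → ℤ
sumRange f lo hi xs = go 0 xs
  where
  go : ℕ → List ℕ → ℤ
  go j [] = + 0
  go j (x ∷ xs) with lo ≤? j | suc j ≤? hi
  ... | yes _ | yes _ = f j x + go (suc j) xs
  ... | _ | _ = go (suc j) xs

δᵣ : (r0 r1 r2 r3 h : ℕ) → ℤ
δᵣ r0 r1 r2 r3 h = + h - sumRange (λ _ x → + x) 0 (Iᵣ r0 r1 r2 r3 h) (rs r0 r1 r2 r3)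

θᵣ : (r0 r1 r2 r3 h : ℕ) → ℤ
θᵣ r0 r1 r2 r3 h = + h - sumRange (λ _ x → + x) (Mᵣ+1 r0 r1 r2 r3 h) 4 (rs r0 r1 r2 r3)

L : (r0 r1 r2 r3 h : ℕ) → ℤ
L r0 r1 r2 r3 h =
  sumRange (λ j x → + (j ℕ.* x)) (Mᵣ+1 r0 r1 r2 r3 h) 4 (rs r0 r1 r2 r3)
  - sumRange (λ j x → + (j ℕ.* x)) 0 (Iᵣ r0 r1 r2 r3 h) (rs r0 r1 r2 r3)
  + Mᵣ r0 r1 r2 r3 h * θᵣ r0 r1 r2 r3 h
  - + Iᵣ r0 r1 r2 r3 h * δᵣ r0 r1 r2 r3 h
  + + 1

{-# OPTIONS --safe #-}
module Submission where

-- Call w(s) = s₁ + 2 s₂ + 3 s₃ the weight of an admissible tuple s (0 ≤ sᵢ ≤ rᵢ, Σ sᵢ = h).  Moving one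
-- unit from position i to i + 1 raises the weight by one and the sum Σ sᵢ aᵢ by aᵢ₊₁ − aᵢ > 0.  From every
-- admissible tuple such shifts lead up to the largest weight and, backwards, down to the smallest, and
-- these extreme weights are the two halves of L(r, h); so every tuple lies on a chain of L tuples with
-- strictly increasing sums, and |h^(r)A| ≥ L.  If two shifts out of one tuple have different gaps, doing
-- them in either order gives a diamond whose two middle sums are distinct and lie strictly between its
-- ends, so the chain through it carries L + 1 sums.  The room h ≤ Σ rᵢ − 2 provides such a diamond unless
-- a₁ − a₀ = a₃ − a₂ and, when r₁ ≥ 2 or r₂ ≥ 2, unless A is an arithmetic progression.  Conversely, under
-- these conditions the sum of a tuple is a function of its weight, so there are at most L sums.

open import Defs
open import Data.Nat as ℕ using (ℕ; zero; suc; pred; _+_; _*_; _∸_; _≤_; _<_; z≤n; s≤s; _≤?_; _<?_)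
import Data.Nat.Properties as ℕP
import Data.Nat.Tactic.RingSolver as ℕ-Solver
open import Data.Integer as ℤ using (ℤ; +_; _-_)
import Data.Integer.Properties as ℤP
import Data.Integer.Tactic.RingSolver as ℤ-Solver
open import Data.Fin as Fin using (Fin)
open import Data.Fin.Properties using (injective⇒≤)
open import Data.List using (List; []; _∷_; _++_; length; map; upTo; lookup; concatMap)
open import Data.List.Properties using (length-++; length-map; length-upTo)
open import Data.List.Relation.Unary.All as All using (All; []; _∷_)
import Data.List.Relation.Unary.All.Properties as AllP
open import Data.List.Relation.Unary.AllPairs as AllPairs using (AllPairs; []; _∷_)
import Data.List.Relation.Unary.AllPairs.Properties as AllPairsP
open import Data.List.Relation.Unary.Linked using (Linked; [-]; _∷_)
open import Data.List.Relation.Unary.Linked.Properties using (Linked⇒AllPairs)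
open import Data.List.Relation.Unary.Unique.Propositional using (Unique)
open import Data.List.Relation.Unary.Unique.DecPropositional.Properties ℤ._≟_ using (deduplicate-!)
open import Data.List.Relation.Binary.Subset.Propositional using (_⊆_)
open import Data.List.Membership.Propositional using (_∈_; lose)
open import Data.List.Membership.Propositional.Properties
  using (∈-lookup; ∈-map⁺; ∈-map⁻; ∈-concatMap⁺; ∈-filter⁺; ∈-filter⁻; ∈-upTo⁺; ∈-upTo⁻;
         ∈-deduplicate⁺; ∈-deduplicate⁻)
open import Data.List.Membership.Setoid.Properties using (index-injective)
open import Data.Product using (Σ; _×_; _,_; proj₁; proj₂; map₂)
open import Data.Sum using (_⊎_; inj₁; inj₂; [_,_]′)
open import Data.Empty using (⊥-elim)
open import Function using (flip; _∘_)
open import Function.Bundles using (_⇔_; mk⇔)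
open import Relation.Binary.PropositionalEquality
open import Relation.Nullary using (¬_; yes; no)
open import Relation.Nullary.Decidable using (decidable-stable)

lookup-injective : ∀ {A : Set} {xs : List A} → Unique xs → ∀ {i j} → lookup xs i ≡ lookup xs j → i ≡ j
lookup-injective (_ ∷ _) {Fin.zero} {Fin.zero} _ = refl
lookup-injective (x∉xs ∷ _) {Fin.zero} {Fin.suc j} x≡ = ⊥-elim (All.lookup x∉xs (∈-lookup j) x≡)
lookup-injective (x∉xs ∷ _) {Fin.suc i} {Fin.zero} ≡x = ⊥-elim (All.lookup x∉xs (∈-lookup i) (sym ≡x))
lookup-injective (_ ∷ unique) {Fin.suc i} {Fin.suc j} e = cong Fin.suc (lookup-injective unique e)

Unique⇒length≤ : ∀ {A : Set} {xs ys : List A} → Unique xs → xs ⊆ ys → length xs ≤ length ys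
Unique⇒length≤ unique xs⊆ys = injective⇒≤ λ {i} {j} e →
  lookup-injective unique (index-injective (setoid _) (xs⊆ys (∈-lookup i)) (xs⊆ys (∈-lookup j)) e)

All-concatMap⁺ : ∀ {A B : Set} {P : B → Set} {f : A → List B} {xs : List A} →
                 (∀ {x} → x ∈ xs → All P (f x)) → All P (concatMap f xs)
All-concatMap⁺ all-f = AllP.concat⁺ (AllP.map⁺ (All.tabulate all-f))

∈-concatMap-∈ : ∀ {A B : Set} {f : A → List B} {x y xs} → x ∈ xs → y ∈ f x → y ∈ concatMap f xs
∈-concatMap-∈ x∈xs y∈fx = ∈-concatMap⁺ _ (lose x∈xs y∈fx)

<⇒≢ : ∀ {i j : ℤ} → i ℤ.< j → i ≢ j
<⇒≢ i<j i≡j = ℤP.<-irrefl i≡j i<j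

All-<-∷ : ∀ {x y : ℤ} {ys} → x ℤ.< y → AllPairs ℤ._<_ (y ∷ ys) → All (x ℤ.<_) (y ∷ ys)
All-<-∷ x<y (y<ys ∷ _) = x<y ∷ All.map (ℤP.<-trans x<y) y<ys

ascending⇒Unique : ∀ {xs : List ℤ} → AllPairs ℤ._<_ xs → Unique xs
ascending⇒Unique = AllPairs.map <⇒≢

Unique-++-∷ : ∀ {x : ℤ} {xs ys} → AllPairs (flip ℤ._<_) (x ∷ xs) → All (x ℤ.<_) ys → Unique ys →
              Unique (xs ++ x ∷ ys)
Unique-++-∷ {x} {ys = ys} (xs<x ∷ descending) x<ys unique-ys =
  AllPairsP.++⁺ (AllPairs.map (λ y<x x≡y → <⇒≢ y<x (sym x≡y)) descending)
                (All.map <⇒≢ x<ys ∷ unique-ys) (All.map separated xs<x)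
  where
  separated : ∀ {d} → d ℤ.< x → All (d ≢_) (x ∷ ys)
  separated d<x = <⇒≢ d<x ∷ All.map (<⇒≢ ∘ ℤP.<-trans d<x) x<ys

i<i+[k-j] : ∀ i {j k : ℤ} → j ℤ.< k → i ℤ.< i ℤ.+ (k - j)
i<i+[k-j] i {j} {k} j<k = subst₂ ℤ._<_ (left i j) (right i j k) (ℤP.+-monoʳ-< (i - j) j<k)
  where
  left : ∀ i j → i - j ℤ.+ j ≡ i
  left = ℤ-Solver.solve-∀
  right : ∀ i j k → i - j ℤ.+ k ≡ i ℤ.+ (k - j)
  right = ℤ-Solver.solve-∀

distribute₂ : ∀ {l₁ u₁ l₂ u₂ n} → l₁ ≤ u₁ → l₂ ≤ u₂ → l₁ + l₂ ≤ n → n ≤ u₁ + u₂ →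
  Σ ℕ λ y₁ → Σ ℕ λ y₂ → (l₁ ≤ y₁ × y₁ ≤ u₁) × (l₂ ≤ y₂ × y₂ ≤ u₂) × y₁ + y₂ ≡ n
distribute₂ {l₁} {u₁} {l₂} {u₂} {n} l₁≤u₁ l₂≤u₂ lo hi with n ≤? u₁ + l₂
... | yes n≤u₁+l₂ =
  n ∸ l₂ , l₂ ,
  (ℕP.m+n≤o⇒m≤o∸n l₁ lo , ℕP.m≤n+o⇒m∸n≤o n l₂ (subst (n ≤_) (ℕP.+-comm u₁ l₂) n≤u₁+l₂)) ,
  (ℕP.≤-refl , l₂≤u₂) ,
  ℕP.m∸n+n≡m (ℕP.≤-trans (ℕP.m≤n+m l₂ l₁) lo)
... | no n≰u₁+l₂ =
  u₁ , n ∸ u₁ ,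
  (l₁≤u₁ , ℕP.≤-refl) ,
  (ℕP.m+n≤o⇒m≤o∸n l₂ (subst (_≤ n) (ℕP.+-comm u₁ l₂) u₁+l₂≤n) , ℕP.m≤n+o⇒m∸n≤o n u₁ hi) ,
  ℕP.m+[n∸m]≡n (ℕP.≤-trans (ℕP.m≤m+n u₁ l₂) u₁+l₂≤n)
  where
  u₁+l₂≤n : u₁ + l₂ ≤ n
  u₁+l₂≤n = ℕP.<⇒≤ (ℕP.≰⇒> n≰u₁+l₂)

module Walks {S V : Set} (Ok Stop : S → Set) (_↝_ : S → S → Set) (height : S → ℕ)
             (_≺_ : V → V → Set) (value : S → V) (P : V → Set)
             (height-↝ : ∀ {s t} → s ↝ t → height s ≡ suc (height t))
             (value-↝ : ∀ {s t} → s ↝ t → value s ≺ value t)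
             (P-value : ∀ {s} → Ok s → P (value s))
             (step : ∀ {s} → Ok s → Stop s ⊎ Σ S λ t → s ↝ t × Ok t) where

  record Walk (s : S) : Set where
    field
      values : List V
      increasing : Linked _≺_ (value s ∷ values)
      values-P : All P values
      end : S
      end-ok : Ok end
      end-stops : Stop end
      height-end : height s ≡ length values + height end

  prepend : ∀ {s t} → s ↝ t → Ok t → Walk t → Walk s
  prepend {t = t} s↝t ok w = record
    { values = value t ∷ values ; increasing = value-↝ s↝t ∷ increasing ; values-P = P-value ok ∷ values-P
    ; end = end ; end-ok = end-ok ; end-stops = end-stops
    ; height-end = trans (height-↝ s↝t) (cong suc height-end) }
    where open Walk w

  walk : ∀ {s} → Ok s → Walk s
  walk ok = go _ refl ok
    where
    go : ∀ n {s} → height s ≡ n → Ok s → Walk s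
    go n e ok with step ok
    go n e ok | inj₁ stop = record
      { values = [] ; increasing = [-] ; values-P = []
      ; end = _ ; end-ok = ok ; end-stops = stop ; height-end = refl }
    go zero e ok | inj₂ (_ , s↝t , _) = ⊥-elim (ℕP.0≢1+n (trans (sym e) (height-↝ s↝t)))
    go (suc n) e ok | inj₂ (_ , s↝t , ok′) =
      prepend s↝t ok′ (go n (ℕP.suc-injective (trans (sym (height-↝ s↝t)) e)) ok′)

Tuple : Set
Tuple = ℕ × ℕ × ℕ × ℕ

_≤ᵗ_ : Tuple → Tuple → Set
(x0 , x1 , x2 , x3) ≤ᵗ (y0 , y1 , y2 , y3) = x0 ≤ y0 × x1 ≤ y1 × x2 ≤ y2 × x3 ≤ y3

total : Tuple → ℕ
total (x0 , x1 , x2 , x3) = x0 + x1 + x2 + x3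

weight : Tuple → ℕ
weight (_ , x1 , x2 , x3) = x1 + 2 * x2 + 3 * x3

coweight : Tuple → ℕ
coweight (x0 , x1 , x2 , _) = 3 * x0 + 2 * x1 + x2

weight+coweight : ∀ s → weight s + coweight s ≡ 3 * total s
weight+coweight (x0 , x1 , x2 , x3) = identity x0 x1 x2 x3
  where
  identity : ∀ x0 x1 x2 x3 → x1 + 2 * x2 + 3 * x3 + (3 * x0 + 2 * x1 + x2) ≡ 3 * (x0 + x1 + x2 + x3)
  identity = ℕ-Solver.solve-∀

distribute : ∀ {n} (l u : Tuple) → l ≤ᵗ u → total l ≤ n → n ≤ total u →
             Σ Tuple λ y → l ≤ᵗ y × y ≤ᵗ u × total y ≡ n
distribute (l0 , l1 , l2 , l3) (u0 , u1 , u2 , u3) (p0 , p1 , p2 , p3) lo hi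
  with distribute₂ (ℕP.+-mono-≤ (ℕP.+-mono-≤ p0 p1) p2) p3 lo hi
... | m₂ , y3 , (lo₂ , hi₂) , (l3≤y3 , y3≤u3) , e₂ with distribute₂ (ℕP.+-mono-≤ p0 p1) p2 lo₂ hi₂
... | m₁ , y2 , (lo₁ , hi₁) , (l2≤y2 , y2≤u2) , e₁ with distribute₂ p0 p1 lo₁ hi₁
... | y0 , y1 , (l0≤y0 , y0≤u0) , (l1≤y1 , y1≤u1) , e₀ =
  (y0 , y1 , y2 , y3) , (l0≤y0 , l1≤y1 , l2≤y2 , l3≤y3) , (y0≤u0 , y1≤u1 , y2≤u2 , y3≤u3) ,
  trans (cong (_+ y3) (trans (cong (_+ y2) e₀) e₁)) e₂

data _⟶_ : Tuple → Tuple → Set where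
  shift₀ : ∀ {x0 x1 x2 x3} → (suc x0 , x1 , x2 , x3) ⟶ (x0 , suc x1 , x2 , x3)
  shift₁ : ∀ {x0 x1 x2 x3} → (x0 , suc x1 , x2 , x3) ⟶ (x0 , x1 , suc x2 , x3)
  shift₂ : ∀ {x0 x1 x2 x3} → (x0 , x1 , suc x2 , x3) ⟶ (x0 , x1 , x2 , suc x3)

total-⟶ : ∀ {s t} → s ⟶ t → total t ≡ total s
total-⟶ (shift₀ {x0} {x1} {x2} {x3}) = identity x0 x1 x2 x3
  where
  identity : ∀ x0 x1 x2 x3 → x0 + suc x1 + x2 + x3 ≡ suc x0 + x1 + x2 + x3
  identity = ℕ-Solver.solve-∀
total-⟶ (shift₁ {x0} {x1} {x2} {x3}) = identity x0 x1 x2 x3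
  where
  identity : ∀ x0 x1 x2 x3 → x0 + x1 + suc x2 + x3 ≡ x0 + suc x1 + x2 + x3
  identity = ℕ-Solver.solve-∀
total-⟶ (shift₂ {x0} {x1} {x2} {x3}) = identity x0 x1 x2 x3
  where
  identity : ∀ x0 x1 x2 x3 → x0 + x1 + x2 + suc x3 ≡ x0 + x1 + suc x2 + x3
  identity = ℕ-Solver.solve-∀

weight-⟶ : ∀ {s t} → s ⟶ t → weight t ≡ suc (weight s)
weight-⟶ shift₀ = refl
weight-⟶ (shift₁ {x1 = x1} {x2} {x3}) = identity x1 x2 x3
  where
  identity : ∀ x1 x2 x3 → x1 + 2 * suc x2 + 3 * x3 ≡ suc (suc x1 + 2 * x2 + 3 * x3)
  identity = ℕ-Solver.solve-∀
weight-⟶ (shift₂ {x1 = x1} {x2} {x3}) = identity x1 x2 x3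
  where
  identity : ∀ x1 x2 x3 → x1 + 2 * x2 + 3 * suc x3 ≡ suc (x1 + 2 * suc x2 + 3 * x3)
  identity = ℕ-Solver.solve-∀

coweight-⟶ : ∀ {s t} → s ⟶ t → coweight s ≡ suc (coweight t)
coweight-⟶ (shift₀ {x0} {x1} {x2}) = identity x0 x1 x2
  where
  identity : ∀ x0 x1 x2 → 3 * suc x0 + 2 * x1 + x2 ≡ suc (3 * x0 + 2 * suc x1 + x2)
  identity = ℕ-Solver.solve-∀
coweight-⟶ (shift₁ {x0} {x1} {x2}) = identity x0 x1 x2
  where
  identity : ∀ x0 x1 x2 → 3 * x0 + 2 * suc x1 + x2 ≡ suc (3 * x0 + 2 * x1 + suc x2)
  identity = ℕ-Solver.solve-∀
coweight-⟶ (shift₂ {x0} {x1} {x2}) = ℕP.+-suc (3 * x0 + 2 * x1) x2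

weightedSum : ℤ → ℤ → ℤ → ℤ → Tuple → ℤ
weightedSum a0 a1 a2 a3 (x0 , x1 , x2 , x3) = + x0 ℤ.* a0 ℤ.+ + x1 ℤ.* a1 ℤ.+ + x2 ℤ.* a2 ℤ.+ + x3 ℤ.* a3

weightedSum-steps : ∀ {a0 a1 a2 a3} d e → a1 ≡ a0 ℤ.+ d → a2 ≡ a0 ℤ.+ e → a3 ≡ a2 ℤ.+ d → ∀ x0 x1 x2 x3 →
  weightedSum a0 a1 a2 a3 (x0 , x1 , x2 , x3)
  ≡ + total (x0 , x1 , x2 , x3) ℤ.* a0 ℤ.+ (+ x1 ℤ.* d ℤ.+ + x2 ℤ.* e ℤ.+ + x3 ℤ.* (e ℤ.+ d))
weightedSum-steps {a0} d e refl refl refl x0 x1 x2 x3 = identity (+ x0) (+ x1) (+ x2) (+ x3) a0 d e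
  where
  identity : ∀ X0 X1 X2 X3 A D E →
    X0 ℤ.* A ℤ.+ X1 ℤ.* (A ℤ.+ D) ℤ.+ X2 ℤ.* (A ℤ.+ E) ℤ.+ X3 ℤ.* (A ℤ.+ E ℤ.+ D)
    ≡ (X0 ℤ.+ X1 ℤ.+ X2 ℤ.+ X3) ℤ.* A ℤ.+ (X1 ℤ.* D ℤ.+ X2 ℤ.* E ℤ.+ X3 ℤ.* (E ℤ.+ D))
  identity = ℤ-Solver.solve-∀

-- With s₁, s₂ ≤ 1 the sum s₁ d + s₂ e + s₃ (e + d) depends only on the weight s₁ + 2 s₂ + 3 s₃.
valueOfWeight : ℤ → ℤ → ℕ → ℤ
valueOfWeight d e 0 = + 0
valueOfWeight d e 1 = d
valueOfWeight d e 2 = e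
valueOfWeight d e (suc (suc (suc w))) = e ℤ.+ d ℤ.+ valueOfWeight d e w

valueOfWeight-+3* : ∀ d e k q → valueOfWeight d e (k + 3 * q) ≡ valueOfWeight d e k ℤ.+ + q ℤ.* (e ℤ.+ d)
valueOfWeight-+3* d e k zero = trans (cong (valueOfWeight d e) (ℕP.+-identityʳ k)) (sym (ℤP.+-identityʳ _))
valueOfWeight-+3* d e k (suc q) = begin
  valueOfWeight d e (k + 3 * suc q)                              ≡⟨ cong (valueOfWeight d e) (three-more k q) ⟩
  e ℤ.+ d ℤ.+ valueOfWeight d e (k + 3 * q)                      ≡⟨ cong (λ v → e ℤ.+ d ℤ.+ v) (valueOfWeight-+3* d e k q) ⟩
  e ℤ.+ d ℤ.+ (valueOfWeight d e k ℤ.+ + q ℤ.* (e ℤ.+ d))        ≡⟨ identity (valueOfWeight d e k) (+ q) d e ⟩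
  valueOfWeight d e k ℤ.+ + suc q ℤ.* (e ℤ.+ d)                  ∎
  where
  open ≡-Reasoning
  three-more : ∀ k q → k + 3 * suc q ≡ suc (suc (suc (k + 3 * q)))
  three-more = ℕ-Solver.solve-∀
  identity : ∀ V Q D E → E ℤ.+ D ℤ.+ (V ℤ.+ Q ℤ.* (E ℤ.+ D)) ≡ V ℤ.+ (+ 1 ℤ.+ Q) ℤ.* (E ℤ.+ D)
  identity = ℤ-Solver.solve-∀

valueOfWeight-≤1 : ∀ d e {x1 x2} → x1 ≤ 1 → x2 ≤ 1 → valueOfWeight d e (x1 + 2 * x2) ≡ + x1 ℤ.* d ℤ.+ + x2 ℤ.* e
valueOfWeight-≤1 d e {0} {0} _ _ = refl
valueOfWeight-≤1 d e {1} {0} _ _ = identity d e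
  where
  identity : ∀ D E → D ≡ + 1 ℤ.* D ℤ.+ + 0 ℤ.* E
  identity = ℤ-Solver.solve-∀
valueOfWeight-≤1 d e {0} {1} _ _ = identity d e
  where
  identity : ∀ D E → E ≡ + 0 ℤ.* D ℤ.+ + 1 ℤ.* E
  identity = ℤ-Solver.solve-∀
valueOfWeight-≤1 d e {1} {1} _ _ = identity d e
  where
  identity : ∀ D E → E ℤ.+ D ℤ.+ + 0 ≡ + 1 ℤ.* D ℤ.+ + 1 ℤ.* E
  identity = ℤ-Solver.solve-∀
valueOfWeight-≤1 d e {suc (suc _)} (s≤s ()) _
valueOfWeight-≤1 d e {_} {suc (suc _)} _ (s≤s ())

module Extremal-weights (r0 r1 r2 r3 : ℕ) where

  -- The two halves Σ_{j>M} j rⱼ + M θ and Σ_{j<I} j rⱼ + I δ of L(r, n): the largest and the smallest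
  -- weight of a tuple with n entries.
  opaque
    maxWeightFrom : ℕ → ℕ → ℤ
    maxWeightFrom m n = sumRange (λ j x → + (j * x)) m 4 (rs r0 r1 r2 r3)
      ℤ.+ (+ m - + 1) ℤ.* (+ n - sumRange (λ _ x → + x) m 4 (rs r0 r1 r2 r3))

    minWeightFrom : ℕ → ℕ → ℤ
    minWeightFrom i n = sumRange (λ j x → + (j * x)) 0 i (rs r0 r1 r2 r3)
      ℤ.+ + i ℤ.* (+ n - sumRange (λ _ x → + x) 0 i (rs r0 r1 r2 r3))

    maxWeight : ℕ → ℤ
    maxWeight n = maxWeightFrom (Mᵣ+1 r0 r1 r2 r3 n) n

    minWeight : ℕ → ℤ
    minWeight n = minWeightFrom (Iᵣ r0 r1 r2 r3 n) n

    L≡maxWeight-minWeight+1 : ∀ n → L r0 r1 r2 r3 n ≡ maxWeight n - minWeight n ℤ.+ + 1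
    L≡maxWeight-minWeight+1 n = rearrange
      (sumRange (λ j x → + (j * x)) (Mᵣ+1 r0 r1 r2 r3 n) 4 (rs r0 r1 r2 r3))
      (sumRange (λ j x → + (j * x)) 0 (Iᵣ r0 r1 r2 r3 n) (rs r0 r1 r2 r3))
      (Mᵣ r0 r1 r2 r3 n ℤ.* θᵣ r0 r1 r2 r3 n) (+ Iᵣ r0 r1 r2 r3 n ℤ.* δᵣ r0 r1 r2 r3 n)
      where
      rearrange : ∀ A B C D → A - B ℤ.+ C - D ℤ.+ + 1 ≡ (A ℤ.+ C) - (B ℤ.+ D) ℤ.+ + 1
      rearrange = ℤ-Solver.solve-∀

    private
      <-≤⇒≱ : ∀ {n a b} → n < a → a ≤ b → ¬ b ≤ n
      <-≤⇒≱ n<a a≤b = ℕP.<⇒≱ (ℕP.<-≤-trans n<a a≤b)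

    Mᵣ+1≡4 : ∀ {n} → n < r3 → Mᵣ+1 r0 r1 r2 r3 n ≡ 4
    Mᵣ+1≡4 {n} n<r3 with r0 + r1 + r2 + r3 ≤? n
    ... | yes p = ⊥-elim (<-≤⇒≱ n<r3 (ℕP.m≤n+m r3 (r0 + r1 + r2)) p)
    ... | no _ with r1 + r2 + r3 ≤? n
    ...   | yes p = ⊥-elim (<-≤⇒≱ n<r3 (ℕP.m≤n+m r3 (r1 + r2)) p)
    ...   | no _ with r2 + r3 ≤? n
    ...     | yes p = ⊥-elim (<-≤⇒≱ n<r3 (ℕP.m≤n+m r3 r2) p)
    ...     | no _ with r3 ≤? n
    ...       | yes p = ⊥-elim (ℕP.<⇒≱ n<r3 p)
    ...       | no _ = refl

    Mᵣ+1≡3 : ∀ {n} → r3 ≤ n → n < r2 + r3 → Mᵣ+1 r0 r1 r2 r3 n ≡ 3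
    Mᵣ+1≡3 {n} lo hi with r0 + r1 + r2 + r3 ≤? n
    ... | yes p = ⊥-elim (<-≤⇒≱ hi (ℕP.+-monoˡ-≤ r3 (ℕP.m≤n+m r2 (r0 + r1))) p)
    ... | no _ with r1 + r2 + r3 ≤? n
    ...   | yes p = ⊥-elim (<-≤⇒≱ hi (ℕP.+-monoˡ-≤ r3 (ℕP.m≤n+m r2 r1)) p)
    ...   | no _ with r2 + r3 ≤? n
    ...     | yes p = ⊥-elim (ℕP.<⇒≱ hi p)
    ...     | no _ with r3 ≤? n
    ...       | yes _ = refl
    ...       | no ¬lo = ⊥-elim (¬lo lo)

    Mᵣ+1≡2 : ∀ {n} → r2 + r3 ≤ n → n < r1 + r2 + r3 → Mᵣ+1 r0 r1 r2 r3 n ≡ 2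
    Mᵣ+1≡2 {n} lo hi with r0 + r1 + r2 + r3 ≤? n
    ... | yes p = ⊥-elim (<-≤⇒≱ hi (ℕP.+-monoˡ-≤ r3 (ℕP.+-monoˡ-≤ r2 (ℕP.m≤n+m r1 r0))) p)
    ... | no _ with r1 + r2 + r3 ≤? n
    ...   | yes p = ⊥-elim (ℕP.<⇒≱ hi p)
    ...   | no _ with r2 + r3 ≤? n
    ...     | yes _ = refl
    ...     | no ¬lo = ⊥-elim (¬lo lo)

    Mᵣ+1≡1 : ∀ {n} → r1 + r2 + r3 ≤ n → n < r0 + r1 + r2 + r3 → Mᵣ+1 r0 r1 r2 r3 n ≡ 1
    Mᵣ+1≡1 {n} lo hi with r0 + r1 + r2 + r3 ≤? n
    ... | yes p = ⊥-elim (ℕP.<⇒≱ hi p)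
    ... | no _ with r1 + r2 + r3 ≤? n
    ...   | yes _ = refl
    ...   | no ¬lo = ⊥-elim (¬lo lo)

    Iᵣ≡0 : ∀ {n} → n < r0 → Iᵣ r0 r1 r2 r3 n ≡ 0
    Iᵣ≡0 {n} hi with r0 + r1 + r2 + r3 ≤? n
    ... | yes p = ⊥-elim (<-≤⇒≱ hi (ℕP.≤-trans (ℕP.≤-trans (ℕP.m≤m+n r0 r1) (ℕP.m≤m+n _ r2)) (ℕP.m≤m+n _ r3)) p)
    ... | no _ with r0 + r1 + r2 ≤? n
    ...   | yes p = ⊥-elim (<-≤⇒≱ hi (ℕP.≤-trans (ℕP.m≤m+n r0 r1) (ℕP.m≤m+n _ r2)) p)
    ...   | no _ with r0 + r1 ≤? n
    ...     | yes p = ⊥-elim (<-≤⇒≱ hi (ℕP.m≤m+n r0 r1) p)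
    ...     | no _ with r0 ≤? n
    ...       | yes p = ⊥-elim (ℕP.<⇒≱ hi p)
    ...       | no _ = refl

    Iᵣ≡1 : ∀ {n} → r0 ≤ n → n < r0 + r1 → Iᵣ r0 r1 r2 r3 n ≡ 1
    Iᵣ≡1 {n} lo hi with r0 + r1 + r2 + r3 ≤? n
    ... | yes p = ⊥-elim (<-≤⇒≱ hi (ℕP.≤-trans (ℕP.m≤m+n _ r2) (ℕP.m≤m+n _ r3)) p)
    ... | no _ with r0 + r1 + r2 ≤? n
    ...   | yes p = ⊥-elim (<-≤⇒≱ hi (ℕP.m≤m+n _ r2) p)
    ...   | no _ with r0 + r1 ≤? n
    ...     | yes p = ⊥-elim (ℕP.<⇒≱ hi p)
    ...     | no _ with r0 ≤? n
    ...       | yes _ = refl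
    ...       | no ¬lo = ⊥-elim (¬lo lo)

    Iᵣ≡2 : ∀ {n} → r0 + r1 ≤ n → n < r0 + r1 + r2 → Iᵣ r0 r1 r2 r3 n ≡ 2
    Iᵣ≡2 {n} lo hi with r0 + r1 + r2 + r3 ≤? n
    ... | yes p = ⊥-elim (<-≤⇒≱ hi (ℕP.m≤m+n _ r3) p)
    ... | no _ with r0 + r1 + r2 ≤? n
    ...   | yes p = ⊥-elim (ℕP.<⇒≱ hi p)
    ...   | no _ with r0 + r1 ≤? n
    ...     | yes _ = refl
    ...     | no ¬lo = ⊥-elim (¬lo lo)

    Iᵣ≡3 : ∀ {n} → r0 + r1 + r2 ≤ n → n < r0 + r1 + r2 + r3 → Iᵣ r0 r1 r2 r3 n ≡ 3
    Iᵣ≡3 {n} lo hi with r0 + r1 + r2 + r3 ≤? n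
    ... | yes p = ⊥-elim (ℕP.<⇒≱ hi p)
    ... | no _ with r0 + r1 + r2 ≤? n
    ...   | yes _ = refl
    ...   | no ¬lo = ⊥-elim (¬lo lo)

    -- `+ (k * r)` unfolds to `R ℤ.+ (⋯ (R ℤ.+ + 0))`, so the identities below are stated in that form.
    maxWeight-packed₃ : ∀ {x3} → x3 < r3 → maxWeight (total (0 , 0 , 0 , x3)) ≡ + weight (0 , 0 , 0 , x3)
    maxWeight-packed₃ {x3} x3<r3 = trans (cong (λ m → maxWeightFrom m x3) (Mᵣ+1≡4 x3<r3)) (identity (+ x3))
      where
      identity : ∀ X → + 0 ℤ.+ (+ 4 - + 1) ℤ.* (X - + 0) ≡ X ℤ.+ (X ℤ.+ (X ℤ.+ + 0))
      identity = ℤ-Solver.solve-∀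

    maxWeight-packed₂ : ∀ {x2 x3} → x2 < r2 → x3 ≡ r3 →
                        maxWeight (total (0 , 0 , x2 , x3)) ≡ + weight (0 , 0 , x2 , x3)
    maxWeight-packed₂ {x2} x2<r2 refl =
      trans (cong (λ m → maxWeightFrom m (x2 + r3)) (Mᵣ+1≡3 (ℕP.m≤n+m r3 x2) (ℕP.+-monoˡ-< r3 x2<r2)))
            (identity (+ x2) (+ r3))
      where
      identity : ∀ X C → (C ℤ.+ (C ℤ.+ (C ℤ.+ + 0))) ℤ.+ + 0 ℤ.+ (+ 3 - + 1) ℤ.* (X ℤ.+ C - (C ℤ.+ + 0))
                         ≡ X ℤ.+ (X ℤ.+ + 0) ℤ.+ (C ℤ.+ (C ℤ.+ (C ℤ.+ + 0)))
      identity = ℤ-Solver.solve-∀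

    maxWeight-packed₁ : ∀ {x1 x2 x3} → x1 < r1 → x2 ≡ r2 → x3 ≡ r3 →
                        maxWeight (total (0 , x1 , x2 , x3)) ≡ + weight (0 , x1 , x2 , x3)
    maxWeight-packed₁ {x1} x1<r1 refl refl =
      trans (cong (λ m → maxWeightFrom m (x1 + r2 + r3))
                  (Mᵣ+1≡2 (ℕP.+-monoˡ-≤ r3 (ℕP.m≤n+m r2 x1)) (ℕP.+-monoˡ-< r3 (ℕP.+-monoˡ-< r2 x1<r1))))
            (identity (+ x1) (+ r2) (+ r3))
      where
      identity : ∀ X B C → (B ℤ.+ (B ℤ.+ + 0)) ℤ.+ ((C ℤ.+ (C ℤ.+ (C ℤ.+ + 0))) ℤ.+ + 0)
                           ℤ.+ (+ 2 - + 1) ℤ.* (X ℤ.+ B ℤ.+ C - (B ℤ.+ (C ℤ.+ + 0)))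
                           ≡ X ℤ.+ (B ℤ.+ (B ℤ.+ + 0)) ℤ.+ (C ℤ.+ (C ℤ.+ (C ℤ.+ + 0)))
      identity = ℤ-Solver.solve-∀

    maxWeight-packed₀ : ∀ {x0 x1 x2 x3} → total (x0 , x1 , x2 , x3) < r0 + r1 + r2 + r3 → x1 ≡ r1 → x2 ≡ r2 → x3 ≡ r3 →
                        maxWeight (total (x0 , x1 , x2 , x3)) ≡ + weight (x0 , x1 , x2 , x3)
    maxWeight-packed₀ {x0} total<N refl refl refl =
      trans (cong (λ m → maxWeightFrom m (x0 + r1 + r2 + r3))
                  (Mᵣ+1≡1 (ℕP.+-monoˡ-≤ r3 (ℕP.+-monoˡ-≤ r2 (ℕP.m≤n+m r1 x0))) total<N))
            (identity (+ (x0 + r1 + r2 + r3)) (+ r1) (+ r2) (+ r3))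
      where
      identity : ∀ N A B C → (A ℤ.+ + 0) ℤ.+ ((B ℤ.+ (B ℤ.+ + 0)) ℤ.+ ((C ℤ.+ (C ℤ.+ (C ℤ.+ + 0))) ℤ.+ + 0))
                             ℤ.+ (+ 1 - + 1) ℤ.* (N - (A ℤ.+ (B ℤ.+ (C ℤ.+ + 0))))
                             ≡ A ℤ.+ (B ℤ.+ (B ℤ.+ + 0)) ℤ.+ (C ℤ.+ (C ℤ.+ (C ℤ.+ + 0)))
      identity = ℤ-Solver.solve-∀

    minWeight-packed₀ : ∀ {x0} → x0 < r0 → minWeight (total (x0 , 0 , 0 , 0)) ≡ + weight (x0 , 0 , 0 , 0)
    minWeight-packed₀ {x0} x0<r0 =
      cong (λ i → minWeightFrom i (x0 + 0 + 0 + 0)) (Iᵣ≡0 (subst (_< r0) (sym (identity x0)) x0<r0))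
      where
      identity : ∀ x → x + 0 + 0 + 0 ≡ x
      identity = ℕ-Solver.solve-∀

    minWeight-packed₁ : ∀ {x0 x1} → x0 ≡ r0 → x1 < r1 →
                        minWeight (total (x0 , x1 , 0 , 0)) ≡ + weight (x0 , x1 , 0 , 0)
    minWeight-packed₁ {x1 = x1} refl x1<r1 =
      trans (cong (λ i → minWeightFrom i (r0 + x1 + 0 + 0))
                  (Iᵣ≡1 (subst (r0 ≤_) (sym (drop-zeros r0 x1)) (ℕP.m≤m+n r0 x1))
                        (subst (_< r0 + r1) (sym (drop-zeros r0 x1)) (ℕP.+-monoʳ-< r0 x1<r1))))
            (identity (+ r0) (+ x1))
      where
      drop-zeros : ∀ a b → a + b + 0 + 0 ≡ a + b
      drop-zeros = ℕ-Solver.solve-∀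
      identity : ∀ R X → + 0 ℤ.+ + 1 ℤ.* (R ℤ.+ X ℤ.+ + 0 ℤ.+ + 0 - (R ℤ.+ + 0)) ≡ X ℤ.+ + 0 ℤ.+ + 0
      identity = ℤ-Solver.solve-∀

    minWeight-packed₂ : ∀ {x0 x1 x2} → x0 ≡ r0 → x1 ≡ r1 → x2 < r2 →
                        minWeight (total (x0 , x1 , x2 , 0)) ≡ + weight (x0 , x1 , x2 , 0)
    minWeight-packed₂ {x2 = x2} refl refl x2<r2 =
      trans (cong (λ i → minWeightFrom i (r0 + r1 + x2 + 0))
                  (Iᵣ≡2 (subst (r0 + r1 ≤_) (sym (ℕP.+-identityʳ _)) (ℕP.m≤m+n (r0 + r1) x2))
                        (subst (_< r0 + r1 + r2) (sym (ℕP.+-identityʳ _)) (ℕP.+-monoʳ-< (r0 + r1) x2<r2))))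
            (identity (+ r0) (+ r1) (+ x2))
      where
      identity : ∀ A B X → ((B ℤ.+ + 0) ℤ.+ + 0) ℤ.+ + 2 ℤ.* (A ℤ.+ B ℤ.+ X ℤ.+ + 0 - (A ℤ.+ (B ℤ.+ + 0)))
                           ≡ B ℤ.+ (X ℤ.+ (X ℤ.+ + 0)) ℤ.+ + 0
      identity = ℤ-Solver.solve-∀

    minWeight-packed₃ : ∀ {x0 x1 x2 x3} → x0 ≡ r0 → x1 ≡ r1 → x2 ≡ r2 → total (x0 , x1 , x2 , x3) < r0 + r1 + r2 + r3 →
                        minWeight (total (x0 , x1 , x2 , x3)) ≡ + weight (x0 , x1 , x2 , x3)
    minWeight-packed₃ {x3 = x3} refl refl refl total<N =
      trans (cong (λ i → minWeightFrom i (r0 + r1 + r2 + x3)) (Iᵣ≡3 (ℕP.m≤m+n (r0 + r1 + r2) x3) total<N))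
            (identity (+ r0) (+ r1) (+ r2) (+ x3))
      where
      identity : ∀ A B C X → ((B ℤ.+ + 0) ℤ.+ ((C ℤ.+ (C ℤ.+ + 0)) ℤ.+ + 0))
                             ℤ.+ + 3 ℤ.* (A ℤ.+ B ℤ.+ C ℤ.+ X - (A ℤ.+ (B ℤ.+ (C ℤ.+ + 0))))
                             ≡ B ℤ.+ (C ℤ.+ (C ℤ.+ + 0)) ℤ.+ (X ℤ.+ (X ℤ.+ (X ℤ.+ + 0)))
      identity = ℤ-Solver.solve-∀

module Restricted-sums (a0 a1 a2 a3 : ℤ) (a0<a1 : a0 ℤ.< a1) (a1<a2 : a1 ℤ.< a2) (a2<a3 : a2 ℤ.< a3)
                       (r0 r1 r2 r3 : ℕ) (0<r0 : 0 < r0) (0<r1 : 0 < r1) (0<r2 : 0 < r2) (0<r3 : 0 < r3)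
                       (h : ℕ) (2≤h : 2 ≤ h) (h+2≤N : h + 2 ≤ r0 + r1 + r2 + r3) where

  open Extremal-weights r0 r1 r2 r3

  r : Tuple
  r = r0 , r1 , r2 , r3

  Admissible : Tuple → Set
  Admissible s = s ≤ᵗ r × total s ≡ h

  val : Tuple → ℤ
  val = weightedSum a0 a1 a2 a3

  sums : List ℤ
  sums = restrictedSumList a0 a1 a2 a3 r0 r1 r2 r3 h

  card : ℕ
  card = card-hrA a0 a1 a2 a3 r0 r1 r2 r3 h

  -- `candidates` is definitionally the list that `tuples` filters.
  column₃ : ℕ → ℕ → ℕ → List Tuple
  column₃ s0 s1 s2 = map (λ s3 → (s0 , s1 , s2 , s3)) (range r3)

  column₂ : ℕ → ℕ → List Tuple
  column₂ s0 s1 = concatMap (column₃ s0 s1) (range r2)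

  column₁ : ℕ → List Tuple
  column₁ s0 = concatMap (column₂ s0) (range r1)

  candidates : List Tuple
  candidates = concatMap column₁ (range r0)

  Admissible⇒∈tuples : ∀ {s} → Admissible s → s ∈ tuples r0 r1 r2 r3 h
  Admissible⇒∈tuples ((b0 , b1 , b2 , b3) , e) =
    ∈-filter⁺ (λ s → total s ℕ.≟ h) {xs = candidates}
      (∈-concatMap-∈ {f = column₁} (∈-upTo⁺ (s≤s b0)) (∈-concatMap-∈ {f = column₂ _} (∈-upTo⁺ (s≤s b1))
        (∈-concatMap-∈ {f = column₃ _ _} (∈-upTo⁺ (s≤s b2)) (∈-map⁺ _ (∈-upTo⁺ (s≤s b3)))))) e

  ∈tuples⇒Admissible : ∀ {s} → s ∈ tuples r0 r1 r2 r3 h → Admissible s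
  ∈tuples⇒Admissible s∈ with ∈-filter⁻ (λ s → total s ℕ.≟ h) {xs = candidates} s∈
  ... | s∈candidates , e = All.lookup bounded s∈candidates , e
    where
    bound : ∀ {x n} → x ∈ upTo (suc n) → x ≤ n
    bound = ℕP.≤-pred ∘ ∈-upTo⁻
    bounded : All (_≤ᵗ r) candidates
    bounded = All-concatMap⁺ λ x0∈ → All-concatMap⁺ λ x1∈ → All-concatMap⁺ λ x2∈ →
                AllP.map⁺ (All.tabulate λ x3∈ → bound x0∈ , bound x1∈ , bound x2∈ , bound x3∈)

  val∈sums : ∀ {s} → Admissible s → val s ∈ sums
  val∈sums adm = ∈-map⁺ _ (Admissible⇒∈tuples adm)

  ∈sums⇒val : ∀ {z} → z ∈ sums → Σ Tuple λ s → Admissible s × z ≡ val s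
  ∈sums⇒val z∈ with ∈-map⁻ _ z∈
  ... | s , s∈ , z≡ = s , ∈tuples⇒Admissible s∈ , z≡

  Unique⇒length≤card : ∀ {zs} → Unique zs → All (_∈ sums) zs → length zs ≤ card
  Unique⇒length≤card unique zs∈ = Unique⇒length≤ unique (∈-deduplicate⁺ ℤ._≟_ ∘ All.lookup zs∈)

  card≤length : ∀ {zs} → sums ⊆ zs → card ≤ length zs
  card≤length sums⊆zs = Unique⇒length≤ (deduplicate-! sums) (sums⊆zs ∘ ∈-deduplicate⁻ ℤ._≟_ sums)

  gap : ∀ {s t} → s ⟶ t → ℤ
  gap shift₀ = a1 - a0
  gap shift₁ = a2 - a1
  gap shift₂ = a3 - a2

  val-⟶ : ∀ {s t} (m : s ⟶ t) → val t ≡ val s ℤ.+ gap m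
  val-⟶ (shift₀ {x0} {x1} {x2} {x3}) = identity (+ x0) (+ x1) (+ x2) (+ x3) a0 a1 a2 a3
    where
    identity : ∀ X0 X1 X2 X3 a0 a1 a2 a3 → X0 ℤ.* a0 ℤ.+ (+ 1 ℤ.+ X1) ℤ.* a1 ℤ.+ X2 ℤ.* a2 ℤ.+ X3 ℤ.* a3
               ≡ (+ 1 ℤ.+ X0) ℤ.* a0 ℤ.+ X1 ℤ.* a1 ℤ.+ X2 ℤ.* a2 ℤ.+ X3 ℤ.* a3 ℤ.+ (a1 - a0)
    identity = ℤ-Solver.solve-∀
  val-⟶ (shift₁ {x0} {x1} {x2} {x3}) = identity (+ x0) (+ x1) (+ x2) (+ x3) a0 a1 a2 a3
    where
    identity : ∀ X0 X1 X2 X3 a0 a1 a2 a3 → X0 ℤ.* a0 ℤ.+ X1 ℤ.* a1 ℤ.+ (+ 1 ℤ.+ X2) ℤ.* a2 ℤ.+ X3 ℤ.* a3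
               ≡ X0 ℤ.* a0 ℤ.+ (+ 1 ℤ.+ X1) ℤ.* a1 ℤ.+ X2 ℤ.* a2 ℤ.+ X3 ℤ.* a3 ℤ.+ (a2 - a1)
    identity = ℤ-Solver.solve-∀
  val-⟶ (shift₂ {x0} {x1} {x2} {x3}) = identity (+ x0) (+ x1) (+ x2) (+ x3) a0 a1 a2 a3
    where
    identity : ∀ X0 X1 X2 X3 a0 a1 a2 a3 → X0 ℤ.* a0 ℤ.+ X1 ℤ.* a1 ℤ.+ X2 ℤ.* a2 ℤ.+ (+ 1 ℤ.+ X3) ℤ.* a3
               ≡ X0 ℤ.* a0 ℤ.+ X1 ℤ.* a1 ℤ.+ (+ 1 ℤ.+ X2) ℤ.* a2 ℤ.+ X3 ℤ.* a3 ℤ.+ (a3 - a2)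
    identity = ℤ-Solver.solve-∀

  <-⟶ : ∀ {s t} → s ⟶ t → val s ℤ.< val t
  <-⟶ {s} m = subst (val s ℤ.<_) (sym (val-⟶ m)) (gap-increases m)
    where
    gap-increases : ∀ {t} (m : s ⟶ t) → val s ℤ.< val s ℤ.+ gap m
    gap-increases shift₀ = i<i+[k-j] (val s) a0<a1
    gap-increases shift₁ = i<i+[k-j] (val s) a1<a2
    gap-increases shift₂ = i<i+[k-j] (val s) a2<a3

  gap-≢⇒val-≢ : ∀ {s t₁ t₂} (m₁ : s ⟶ t₁) (m₂ : s ⟶ t₂) → gap m₁ ≢ gap m₂ → val t₁ ≢ val t₂
  gap-≢⇒val-≢ {s} m₁ m₂ gaps≢ vals≡ = gaps≢ (begin
    gap m₁                       ≡⟨ cancel (val s) (gap m₁) ⟨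
    val s ℤ.+ gap m₁ - val s     ≡⟨ cong (_- val s) (trans (sym (val-⟶ m₁)) (trans vals≡ (val-⟶ m₂))) ⟩
    val s ℤ.+ gap m₂ - val s     ≡⟨ cancel (val s) (gap m₂) ⟩
    gap m₂                       ∎)
    where
    open ≡-Reasoning
    cancel : ∀ v g → v ℤ.+ g - v ≡ g
    cancel = ℤ-Solver.solve-∀

  moved : ∀ {s t} → total s ≡ h → s ⟶ t → t ≤ᵗ r → Admissible t
  moved e m t≤r = t≤r , trans (total-⟶ m) e

  h<N : h < r0 + r1 + r2 + r3
  h<N = ℕP.<-≤-trans (ℕP.m<m+n h (s≤s z≤n)) h+2≤N

  record Heaviest (s : Tuple) : Set where
    constructor heaviest
    field weight≡maxWeight : + weight s ≡ maxWeight h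

  record Lightest (s : Tuple) : Set where
    constructor lightest
    field weight≡minWeight : + weight s ≡ minWeight h

  Rise : Tuple → Set
  Rise s = Heaviest s ⊎ Σ Tuple λ t → s ⟶ t × Admissible t

  Fall : Tuple → Set
  Fall s = Lightest s ⊎ Σ Tuple λ t → t ⟶ s × Admissible t

  summit : ∀ {s} → total s ≡ h → maxWeight (total s) ≡ + weight s → Rise s
  summit e packed = inj₁ (heaviest (trans (sym packed) (cong maxWeight e)))

  ascend : ∀ {s t} → total s ≡ h → s ⟶ t → t ≤ᵗ r → Rise s
  ascend e m t≤r = inj₂ (_ , m , moved e m t≤r)

  bottom : ∀ {s} → total s ≡ h → minWeight (total s) ≡ + weight s → Fall s
  bottom e packed = inj₁ (lightest (trans (sym packed) (cong minWeight e)))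

  descend : ∀ {s t} → total t ≡ h → s ⟶ t → s ≤ᵗ r → Fall t
  descend e m s≤r = inj₂ (_ , m , s≤r , trans (sym (total-⟶ m)) e)

  rise : ∀ {s} → Admissible s → Rise s
  rise {x0 , x1 , x2 , x3} adm with x3 <? r3
  rise {x0 , x1 , suc x2 , x3} ((b0 , b1 , b2 , _) , e) | yes p = ascend e shift₂ (b0 , b1 , ℕP.<⇒≤ b2 , p)
  rise {x0 , suc x1 , 0 , x3} ((b0 , b1 , _ , b3) , e) | yes _ = ascend e shift₁ (b0 , ℕP.<⇒≤ b1 , 0<r2 , b3)
  rise {suc x0 , 0 , 0 , x3} ((b0 , _ , b2 , b3) , e) | yes _ = ascend e shift₀ (ℕP.<⇒≤ b0 , 0<r1 , b2 , b3)
  rise {0 , 0 , 0 , x3} (_ , e) | yes p = summit e (maxWeight-packed₃ p)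
  rise {x0 , x1 , x2 , x3} adm | no ¬p with x2 <? r2
  rise {x0 , suc x1 , x2 , x3} ((b0 , b1 , _ , b3) , e) | no _ | yes q = ascend e shift₁ (b0 , ℕP.<⇒≤ b1 , q , b3)
  rise {suc x0 , 0 , x2 , x3} ((b0 , _ , b2 , b3) , e) | no _ | yes _ = ascend e shift₀ (ℕP.<⇒≤ b0 , 0<r1 , b2 , b3)
  rise {0 , 0 , x2 , x3} ((_ , _ , _ , b3) , e) | no ¬p | yes q = summit e (maxWeight-packed₂ q (ℕP.≤∧≮⇒≡ b3 ¬p))
  rise {x0 , x1 , x2 , x3} adm | no ¬p | no ¬q with x1 <? r1
  rise {suc x0 , x1 , x2 , x3} ((b0 , _ , b2 , b3) , e) | no _ | no _ | yes t = ascend e shift₀ (ℕP.<⇒≤ b0 , t , b2 , b3)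
  rise {0 , x1 , x2 , x3} ((_ , _ , b2 , b3) , e) | no ¬p | no ¬q | yes t =
    summit e (maxWeight-packed₁ t (ℕP.≤∧≮⇒≡ b2 ¬q) (ℕP.≤∧≮⇒≡ b3 ¬p))
  rise {x0 , x1 , x2 , x3} ((_ , b1 , b2 , b3) , e) | no ¬p | no ¬q | no ¬t =
    summit e (maxWeight-packed₀ (subst (_< _) (sym e) h<N) (ℕP.≤∧≮⇒≡ b1 ¬t) (ℕP.≤∧≮⇒≡ b2 ¬q) (ℕP.≤∧≮⇒≡ b3 ¬p))

  fall : ∀ {s} → Admissible s → Fall s
  fall {x0 , x1 , x2 , x3} adm with x0 <? r0
  fall {x0 , suc x1 , x2 , x3} ((_ , b1 , b2 , b3) , e) | yes p = descend e shift₀ (p , ℕP.<⇒≤ b1 , b2 , b3)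
  fall {x0 , 0 , suc x2 , x3} ((b0 , _ , b2 , b3) , e) | yes _ = descend e shift₁ (b0 , 0<r1 , ℕP.<⇒≤ b2 , b3)
  fall {x0 , 0 , 0 , suc x3} ((b0 , b1 , _ , b3) , e) | yes _ = descend e shift₂ (b0 , b1 , 0<r2 , ℕP.<⇒≤ b3)
  fall {x0 , 0 , 0 , 0} (_ , e) | yes p = bottom e (minWeight-packed₀ p)
  fall {x0 , x1 , x2 , x3} adm | no ¬p with x1 <? r1
  fall {x0 , x1 , suc x2 , x3} ((b0 , _ , b2 , b3) , e) | no _ | yes q = descend e shift₁ (b0 , q , ℕP.<⇒≤ b2 , b3)
  fall {x0 , x1 , 0 , suc x3} ((b0 , b1 , _ , b3) , e) | no _ | yes _ = descend e shift₂ (b0 , b1 , 0<r2 , ℕP.<⇒≤ b3)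
  fall {x0 , x1 , 0 , 0} ((b0 , _ , _ , _) , e) | no ¬p | yes q = bottom e (minWeight-packed₁ (ℕP.≤∧≮⇒≡ b0 ¬p) q)
  fall {x0 , x1 , x2 , x3} adm | no ¬p | no ¬q with x2 <? r2
  fall {x0 , x1 , x2 , suc x3} ((b0 , b1 , _ , b3) , e) | no _ | no _ | yes t = descend e shift₂ (b0 , b1 , t , ℕP.<⇒≤ b3)
  fall {x0 , x1 , x2 , 0} ((b0 , b1 , _ , _) , e) | no ¬p | no ¬q | yes t =
    bottom e (minWeight-packed₂ (ℕP.≤∧≮⇒≡ b0 ¬p) (ℕP.≤∧≮⇒≡ b1 ¬q) t)
  fall {x0 , x1 , x2 , x3} ((b0 , b1 , b2 , _) , e) | no ¬p | no ¬q | no ¬t =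
    bottom e (minWeight-packed₃ (ℕP.≤∧≮⇒≡ b0 ¬p) (ℕP.≤∧≮⇒≡ b1 ¬q) (ℕP.≤∧≮⇒≡ b2 ¬t) (subst (_< _) (sym e) h<N))

  module Ascent = Walks Admissible Heaviest _⟶_ coweight ℤ._<_ val (_∈ sums) coweight-⟶ <-⟶ val∈sums rise
  module Descent =
    Walks Admissible Lightest (flip _⟶_) weight (flip ℤ._<_) val (_∈ sums) weight-⟶ <-⟶ val∈sums fall

  coweight-trade : ∀ {s t n} → Admissible s → Admissible t →
                   coweight s ≡ n + coweight t → weight s + n ≡ weight t
  coweight-trade {s} {t} {n} (_ , es) (_ , et) c = ℕP.+-cancelʳ-≡ (coweight t) _ _ (begin
    weight s + n + coweight t     ≡⟨ ℕP.+-assoc (weight s) n (coweight t) ⟩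
    weight s + (n + coweight t)   ≡⟨ cong (weight s ℕ.+_) c ⟨
    weight s + coweight s         ≡⟨ weight+coweight s ⟩
    3 * total s                   ≡⟨ cong (3 *_) (trans es (sym et)) ⟩
    3 * total t                   ≡⟨ weight+coweight t ⟨
    weight t + coweight t         ∎)
    where open ≡-Reasoning

  record Profile (s : Tuple) : Set where
    field
      below above : List ℤ
      descending : AllPairs (flip ℤ._<_) (val s ∷ below)
      ascending : AllPairs ℤ._<_ (val s ∷ above)
      below∈sums : All (_∈ sums) below
      above∈sums : All (_∈ sums) above
      floor : ℕ
      floor-lightest : + floor ≡ minWeight h
      weight≡below+floor : weight s ≡ length below + floor
      weight+above-heaviest : + (weight s + length above) ≡ maxWeight h

  opaque
    profile : ∀ {s} → Admissible s → Profile s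
    profile adm = record
      { below = D.values ; above = A.values
      ; descending = Linked⇒AllPairs (flip ℤP.<-trans) D.increasing
      ; ascending = Linked⇒AllPairs ℤP.<-trans A.increasing
      ; below∈sums = D.values-P ; above∈sums = A.values-P
      ; floor = weight D.end
      ; floor-lightest = Lightest.weight≡minWeight D.end-stops
      ; weight≡below+floor = D.height-end
      ; weight+above-heaviest =
          trans (cong +_ (coweight-trade adm A.end-ok A.height-end)) (Heaviest.weight≡maxWeight A.end-stops)
      }
      where
      module A = Ascent.Walk (Ascent.walk adm)
      module D = Descent.Walk (Descent.walk adm)

  module _ {s} (adm : Admissible s) where
    open Profile (profile adm)

    L≡suc[below+above] : L r0 r1 r2 r3 h ≡ + suc (length below + length above)
    L≡suc[below+above] = begin
      L r0 r1 r2 r3 h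
        ≡⟨ L≡maxWeight-minWeight+1 h ⟩
      maxWeight h - minWeight h ℤ.+ + 1
        ≡⟨ cong₂ (λ M m → M - m ℤ.+ + 1) weight+above-heaviest floor-lightest ⟨
      + (weight s + length above) - + floor ℤ.+ + 1
        ≡⟨ cong (λ w → + (w + length above) - + floor ℤ.+ + 1) weight≡below+floor ⟩
      + (length below + floor + length above) - + floor ℤ.+ + 1
        ≡⟨ cancel (+ length below) (+ floor) (+ length above) ⟩
      + suc (length below + length above) ∎
      where
      open ≡-Reasoning
      cancel : ∀ B F A → B ℤ.+ F ℤ.+ A - F ℤ.+ + 1 ≡ + 1 ℤ.+ (B ℤ.+ A)
      cancel = ℤ-Solver.solve-∀

    suc[below+above]≤card : suc (length below + length above) ≤ card
    suc[below+above]≤card = subst (_≤ card) (trans (length-++ below) (ℕP.+-suc _ _)) (Unique⇒length≤card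
      (Unique-++-∷ descending (AllPairs.head ascending) (ascending⇒Unique (AllPairs.tail ascending)))
      (AllP.++⁺ below∈sums (val∈sums adm ∷ above∈sums)))

  opaque
    some-admissible : Σ Tuple Admissible
    some-admissible = map₂ proj₂ (distribute (0 , 0 , 0 , 0) r (z≤n , z≤n , z≤n , z≤n) z≤n (ℕP.<⇒≤ h<N))

  weight-determined⇒card≤ : (g : ℕ → ℤ) → (∀ {t} → Admissible t → val t ≡ g (weight t)) →
    ∀ {s} (adm : Admissible s) → let open Profile (profile adm) in card ≤ suc (length below + length above)
  weight-determined⇒card≤ g val≡g adm =
    subst (card ≤_) (trans (length-map _ (upTo (suc K))) (length-upTo (suc K))) (card≤length sums⊆values)
    where
    open Profile (profile adm)
    K : ℕ
    K = length below + length above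
    values : List ℤ
    values = map (λ i → g (i + floor)) (upTo (suc K))
    sums⊆values : sums ⊆ values
    sums⊆values z∈ with ∈sums⇒val z∈
    ... | t , adm-t , refl =
      subst (_∈ values) (sym (trans (val≡g adm-t) (cong g weight-t))) (∈-map⁺ _ (∈-upTo⁺ (s≤s below-t≤K)))
      where
      module T = Profile (profile adm-t)
      weight-t : weight t ≡ length T.below + floor
      weight-t = trans T.weight≡below+floor
        (cong (length T.below ℕ.+_) (ℤP.+-injective (trans T.floor-lightest (sym floor-lightest))))
      below-t≤K : length T.below ≤ K
      below-t≤K = subst (length T.below ≤_)
        (ℕP.suc-injective (ℤP.+-injective (trans (sym (L≡suc[below+above] adm-t)) (L≡suc[below+above] adm))))
        (ℕP.m≤m+n (length T.below) (length T.above))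

  weight-determined⇒card≡L : (g : ℕ → ℤ) → (∀ {t} → Admissible t → val t ≡ g (weight t)) →
                             + card ≡ L r0 r1 r2 r3 h
  weight-determined⇒card≡L g val≡g =
    trans (cong +_ (ℕP.≤-antisym (weight-determined⇒card≤ g val≡g adm) (suc[below+above]≤card adm)))
          (sym (L≡suc[below+above] adm))
    where
    adm : Admissible (proj₁ some-admissible)
    adm = proj₂ some-admissible

  data Diamond : Set where
    diamond : ∀ {s t₁ t₂ u} → Admissible s → (s⟶t₁ : s ⟶ t₁) (s⟶t₂ : s ⟶ t₂) → t₁ ⟶ u → t₂ ⟶ u →
              t₁ ≤ᵗ r → t₂ ≤ᵗ r → u ≤ᵗ r → gap s⟶t₁ ≢ gap s⟶t₂ → Diamond

  diamond⇒card≢L : Diamond → + card ≢ L r0 r1 r2 r3 h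
  diamond⇒card≢L (diamond {s} {t₁} {t₂} {u} adm s⟶t₁ s⟶t₂ t₁⟶u t₂⟶u t₁≤r t₂≤r u≤r gaps≢) card≡L =
    ℕP.1+n≰n (ℕP.≤-pred (begin
      suc (suc (length P.below + suc (suc (length Q.above))))  ≡⟨ longer ⟩
      length chain                                               ≤⟨ Unique⇒length≤card chain-unique chain∈sums ⟩
      card                                                       ≡⟨ card≡ ⟩
      suc (length P.below + suc (suc (length Q.above)))        ∎))
    where
    open ℕP.≤-Reasoning
    adm₁ : Admissible t₁
    adm₁ = moved (proj₂ adm) s⟶t₁ t₁≤r
    adm₂ : Admissible t₂
    adm₂ = moved (proj₂ adm) s⟶t₂ t₂≤r
    admᵤ : Admissible u
    admᵤ = moved (proj₂ adm₁) t₁⟶u u≤r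
    module P = Profile (profile adm)
    module Q = Profile (profile admᵤ)
    chain : List ℤ
    chain = P.below ++ val s ∷ val t₁ ∷ val t₂ ∷ val u ∷ Q.above
    chain-unique : Unique chain
    chain-unique = Unique-++-∷ P.descending
      (<-⟶ s⟶t₁ ∷ <-⟶ s⟶t₂ ∷ All-<-∷ (ℤP.<-trans (<-⟶ s⟶t₁) (<-⟶ t₁⟶u)) Q.ascending)
      ((gap-≢⇒val-≢ s⟶t₁ s⟶t₂ gaps≢ ∷ All.map <⇒≢ (All-<-∷ (<-⟶ t₁⟶u) Q.ascending))
       ∷ All.map <⇒≢ (All-<-∷ (<-⟶ t₂⟶u) Q.ascending)
       ∷ ascending⇒Unique Q.ascending)
    chain∈sums : All (_∈ sums) chain
    chain∈sums = AllP.++⁺ P.below∈sums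
      (val∈sums adm ∷ val∈sums adm₁ ∷ val∈sums adm₂ ∷ val∈sums admᵤ ∷ Q.above∈sums)
    longer : suc (suc (length P.below + suc (suc (length Q.above)))) ≡ length chain
    longer = sym (trans (length-++ P.below) (trans (ℕP.+-suc _ _) (cong suc (ℕP.+-suc _ _))))
    above-shrinks : length P.above ≡ suc (suc (length Q.above))
    above-shrinks = ℕP.+-cancelˡ-≡ (weight s) _ _ (trans
      (ℤP.+-injective (trans P.weight+above-heaviest (sym Q.weight+above-heaviest)))
      (trans (cong (_+ length Q.above) (trans (weight-⟶ t₁⟶u) (cong suc (weight-⟶ s⟶t₁))))
             (sym (trans (ℕP.+-suc _ _) (cong suc (ℕP.+-suc _ _))))))
    card≡ : card ≡ suc (length P.below + suc (suc (length Q.above)))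
    card≡ = trans (ℤP.+-injective (trans card≡L (L≡suc[below+above] adm)))
                  (cong (λ n → suc (length P.below + n)) above-shrinks)

  ≤pred⇒< : ∀ {y n} → 0 < n → y ≤ pred n → y < n
  ≤pred⇒< 0<n = ℕP.m≤pred[n]⇒suc[m]≤n {{ℕ.>-nonZero 0<n}}

  suc-pred : ∀ {n} → 0 < n → suc (pred n) ≡ n
  suc-pred 0<n = ℕP.suc-pred _ {{ℕ.>-nonZero 0<n}}

  h≤total : ∀ u → total u + 2 ≡ r0 + r1 + r2 + r3 → h ≤ total u
  h≤total u e = ℕP.+-cancelʳ-≤ 2 h (total u) (subst (h + 2 ≤_) (sym e) h+2≤N)

  diamond₀₂ : a1 - a0 ≢ a3 - a2 → Diamond
  diamond₀₂ gaps≢ =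
    from-box (distribute (1 , 0 , 1 , 0) box (0<r0 , z≤n , 0<r2 , z≤n) 2≤h (h≤total box box-total))
    where
    box : Tuple
    box = r0 , pred r1 , r2 , pred r3
    box-total : total box + 2 ≡ r0 + r1 + r2 + r3
    box-total = trans (identity r0 (pred r1) r2 (pred r3))
                      (cong₂ (λ b d → r0 + b + r2 + d) (suc-pred 0<r1) (suc-pred 0<r3))
      where
      identity : ∀ a b c d → a + b + c + d + 2 ≡ a + suc b + c + suc d
      identity = ℕ-Solver.solve-∀
    from-box : Σ Tuple (λ y → (1 , 0 , 1 , 0) ≤ᵗ y × y ≤ᵗ box × total y ≡ h) → Diamond
    from-box ((suc x0 , x1 , suc x2 , x3) , (s≤s _ , _ , s≤s _ , _) , (b0 , b1 , b2 , b3) , e) =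
      diamond ((b0 , ℕP.≤pred⇒≤ b1 , b2 , ℕP.≤pred⇒≤ b3) , e) shift₀ shift₂ shift₂ shift₀
              (ℕP.<⇒≤ b0 , ≤pred⇒< 0<r1 b1 , b2 , ℕP.≤pred⇒≤ b3)
              (b0 , ℕP.≤pred⇒≤ b1 , ℕP.<⇒≤ b2 , ≤pred⇒< 0<r3 b3)
              (ℕP.<⇒≤ b0 , ≤pred⇒< 0<r1 b1 , ℕP.<⇒≤ b2 , ≤pred⇒< 0<r3 b3) gaps≢

  diamond₀₁ : 2 ≤ r1 → a1 - a0 ≢ a2 - a1 → Diamond
  diamond₀₁ 2≤r1 gaps≢ =
    from-box (distribute (1 , 1 , 0 , 0) box (0<r0 , ℕP.suc[m]≤n⇒m≤pred[n] 2≤r1 , z≤n , z≤n) 2≤h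
                         (h≤total box box-total))
    where
    box : Tuple
    box = r0 , pred r1 , pred r2 , r3
    box-total : total box + 2 ≡ r0 + r1 + r2 + r3
    box-total = trans (identity r0 (pred r1) (pred r2) r3)
                      (cong₂ (λ b c → r0 + b + c + r3) (suc-pred 0<r1) (suc-pred 0<r2))
      where
      identity : ∀ a b c d → a + b + c + d + 2 ≡ a + suc b + suc c + d
      identity = ℕ-Solver.solve-∀
    from-box : Σ Tuple (λ y → (1 , 1 , 0 , 0) ≤ᵗ y × y ≤ᵗ box × total y ≡ h) → Diamond
    from-box ((suc x0 , suc x1 , x2 , x3) , (s≤s _ , s≤s _ , _ , _) , (b0 , b1 , b2 , b3) , e) =
      diamond ((b0 , ℕP.≤pred⇒≤ b1 , ℕP.≤pred⇒≤ b2 , b3) , e) shift₀ shift₁ shift₁ shift₀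
              (ℕP.<⇒≤ b0 , ≤pred⇒< 0<r1 b1 , ℕP.≤pred⇒≤ b2 , b3)
              (b0 , ℕP.<⇒≤ (ℕP.≤pred⇒≤ b1) , ≤pred⇒< 0<r2 b2 , b3)
              (ℕP.<⇒≤ b0 , ℕP.≤pred⇒≤ b1 , ≤pred⇒< 0<r2 b2 , b3) gaps≢

  diamond₁₂ : 2 ≤ r2 → a2 - a1 ≢ a3 - a2 → Diamond
  diamond₁₂ 2≤r2 gaps≢ =
    from-box (distribute (0 , 1 , 1 , 0) box (z≤n , 0<r1 , ℕP.suc[m]≤n⇒m≤pred[n] 2≤r2 , z≤n) 2≤h
                         (h≤total box box-total))
    where
    box : Tuple
    box = r0 , r1 , pred r2 , pred r3
    box-total : total box + 2 ≡ r0 + r1 + r2 + r3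
    box-total = trans (identity r0 r1 (pred r2) (pred r3))
                      (cong₂ (λ c d → r0 + r1 + c + d) (suc-pred 0<r2) (suc-pred 0<r3))
      where
      identity : ∀ a b c d → a + b + c + d + 2 ≡ a + b + suc c + suc d
      identity = ℕ-Solver.solve-∀
    from-box : Σ Tuple (λ y → (0 , 1 , 1 , 0) ≤ᵗ y × y ≤ᵗ box × total y ≡ h) → Diamond
    from-box ((x0 , suc x1 , suc x2 , x3) , (_ , s≤s _ , s≤s _ , _) , (b0 , b1 , b2 , b3) , e) =
      diamond ((b0 , b1 , ℕP.≤pred⇒≤ b2 , ℕP.≤pred⇒≤ b3) , e) shift₁ shift₂ shift₂ shift₁
              (b0 , ℕP.<⇒≤ b1 , ≤pred⇒< 0<r2 b2 , ℕP.≤pred⇒≤ b3)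
              (b0 , b1 , ℕP.<⇒≤ (ℕP.≤pred⇒≤ b2) , ≤pred⇒< 0<r3 b3)
              (b0 , ℕP.<⇒≤ b1 , ℕP.≤pred⇒≤ b2 , ≤pred⇒< 0<r3 b3) gaps≢

  a≡b+[a-b] : ∀ a b → a ≡ b ℤ.+ (a - b)
  a≡b+[a-b] = ℤ-Solver.solve-∀

  val-arithmetic : a1 - a0 ≡ a2 - a1 → a2 - a1 ≡ a3 - a2 →
                   ∀ {t} → Admissible t → val t ≡ + h ℤ.* a0 ℤ.+ + weight t ℤ.* (a1 - a0)
  val-arithmetic d₁≡d₂ d₂≡d₃ {x0 , x1 , x2 , x3} (_ , e) = begin
    val (x0 , x1 , x2 , x3)
      ≡⟨ weightedSum-steps d (d ℤ.+ d) (a≡b+[a-b] a1 a0) a2≡ a3≡ x0 x1 x2 x3 ⟩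
    + total (x0 , x1 , x2 , x3) ℤ.* a0
      ℤ.+ (+ x1 ℤ.* d ℤ.+ + x2 ℤ.* (d ℤ.+ d) ℤ.+ + x3 ℤ.* (d ℤ.+ d ℤ.+ d))
      ≡⟨ cong₂ (λ n w → + n ℤ.* a0 ℤ.+ w) e (identity (+ x1) (+ x2) (+ x3) d) ⟩
    + h ℤ.* a0 ℤ.+ + weight (x0 , x1 , x2 , x3) ℤ.* d ∎
    where
    open ≡-Reasoning
    d : ℤ
    d = a1 - a0
    a2≡ : a2 ≡ a0 ℤ.+ (d ℤ.+ d)
    a2≡ = trans (a≡b+[a-b] a2 a1) (trans (cong₂ ℤ._+_ (a≡b+[a-b] a1 a0) (sym d₁≡d₂)) (ℤP.+-assoc a0 d d))
    a3≡ : a3 ≡ a2 ℤ.+ d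
    a3≡ = trans (a≡b+[a-b] a3 a2) (cong (ℤ._+_ a2) (sym (trans d₁≡d₂ d₂≡d₃)))
    identity : ∀ X1 X2 X3 D → X1 ℤ.* D ℤ.+ X2 ℤ.* (D ℤ.+ D) ℤ.+ X3 ℤ.* (D ℤ.+ D ℤ.+ D)
               ≡ (X1 ℤ.+ (X2 ℤ.+ (X2 ℤ.+ + 0)) ℤ.+ (X3 ℤ.+ (X3 ℤ.+ (X3 ℤ.+ + 0)))) ℤ.* D
    identity = ℤ-Solver.solve-∀

  val-r₁=r₂=1 : r1 ≡ 1 → r2 ≡ 1 → a1 - a0 ≡ a3 - a2 →
                ∀ {t} → Admissible t → val t ≡ + h ℤ.* a0 ℤ.+ valueOfWeight (a1 - a0) (a2 - a0) (weight t)
  val-r₁=r₂=1 r1≡1 r2≡1 d₁≡d₃ {x0 , x1 , x2 , x3} ((_ , b1 , b2 , _) , e) = begin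
    val (x0 , x1 , x2 , x3)
      ≡⟨ weightedSum-steps d d′ (a≡b+[a-b] a1 a0) (a≡b+[a-b] a2 a0) a3≡ x0 x1 x2 x3 ⟩
    + total (x0 , x1 , x2 , x3) ℤ.* a0 ℤ.+ (+ x1 ℤ.* d ℤ.+ + x2 ℤ.* d′ ℤ.+ + x3 ℤ.* (d′ ℤ.+ d))
      ≡⟨ cong₂ (λ n v → + n ℤ.* a0 ℤ.+ v) e (sym by-weight) ⟩
    + h ℤ.* a0 ℤ.+ valueOfWeight d d′ (weight (x0 , x1 , x2 , x3)) ∎
    where
    open ≡-Reasoning
    d d′ : ℤ
    d = a1 - a0
    d′ = a2 - a0
    a3≡ : a3 ≡ a2 ℤ.+ d
    a3≡ = trans (a≡b+[a-b] a3 a2) (cong (ℤ._+_ a2) (sym d₁≡d₃))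
    by-weight : valueOfWeight d d′ (x1 + 2 * x2 + 3 * x3) ≡ + x1 ℤ.* d ℤ.+ + x2 ℤ.* d′ ℤ.+ + x3 ℤ.* (d′ ℤ.+ d)
    by-weight = trans (valueOfWeight-+3* d d′ (x1 + 2 * x2) x3) (cong (λ v → v ℤ.+ + x3 ℤ.* (d′ ℤ.+ d))
                      (valueOfWeight-≤1 d d′ (subst (x1 ≤_) r1≡1 b1) (subst (x2 ≤_) r2≡1 b2)))

  part-i : r1 ≡ 1 × r2 ≡ 1 → (+ card ≡ L r0 r1 r2 r3 h) ⇔ (a1 - a0 ≡ a3 - a2)
  part-i (r1≡1 , r2≡1) = mk⇔
    (λ card≡L → decidable-stable (a1 - a0 ℤ.≟ a3 - a2) λ d₁≢d₃ → diamond⇒card≢L (diamond₀₂ d₁≢d₃) card≡L)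
    (λ d₁≡d₃ → weight-determined⇒card≡L (λ w → + h ℤ.* a0 ℤ.+ valueOfWeight (a1 - a0) (a2 - a0) w)
                                         (val-r₁=r₂=1 r1≡1 r2≡1 d₁≡d₃))

  part-ii : 2 ≤ r1 ⊎ 2 ≤ r2 → (+ card ≡ L r0 r1 r2 r3 h) ⇔ (a1 - a0 ≡ a2 - a1 × a2 - a1 ≡ a3 - a2)
  part-ii 2≤r₁⊎2≤r₂ = mk⇔ arithmetic λ (d₁≡d₂ , d₂≡d₃) →
    weight-determined⇒card≡L (λ w → + h ℤ.* a0 ℤ.+ + w ℤ.* (a1 - a0)) (val-arithmetic d₁≡d₂ d₂≡d₃)
    where
    arithmetic : + card ≡ L r0 r1 r2 r3 h → a1 - a0 ≡ a2 - a1 × a2 - a1 ≡ a3 - a2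
    arithmetic card≡L = d₁≡d₂ , trans (sym d₁≡d₂) d₁≡d₃
      where
      no-diamond : ¬ Diamond
      no-diamond D = diamond⇒card≢L D card≡L
      d₁≡d₃ : a1 - a0 ≡ a3 - a2
      d₁≡d₃ = decidable-stable (a1 - a0 ℤ.≟ a3 - a2) (no-diamond ∘ diamond₀₂)
      bent : a1 - a0 ≢ a2 - a1 → Diamond
      bent = [ diamond₀₁ , (λ 2≤r2 d₁≢d₂ → diamond₁₂ 2≤r2 λ d₂≡d₃ → d₁≢d₂ (trans d₁≡d₃ (sym d₂≡d₃))) ]′ 2≤r₁⊎2≤r₂
      d₁≡d₂ : a1 - a0 ≡ a2 - a1
      d₁≡d₂ = decidable-stable (a1 - a0 ℤ.≟ a2 - a1) (no-diamond ∘ bent)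

theorem4 : (a0 a1 a2 a3 : ℤ) → a0 ℤ.< a1 → a1 ℤ.< a2 → a2 ℤ.< a3 →
    (r0 r1 r2 r3 : ℕ) → 1 ≤ r0 → 1 ≤ r1 → 1 ≤ r2 → 1 ≤ r3 →
    (h : ℕ) → 2 ≤ h → h ≤ (r0 + r1 + r2 + r3) ∸ 2 →
    ((r1 ≡ 1 × r2 ≡ 1) →
      ((+ card-hrA a0 a1 a2 a3 r0 r1 r2 r3 h ≡ L r0 r1 r2 r3 h) ⇔ (a1 - a0 ≡ a3 - a2)))
    × ((2 ≤ r1 ⊎ 2 ≤ r2) →
      ((+ card-hrA a0 a1 a2 a3 r0 r1 r2 r3 h ≡ L r0 r1 r2 r3 h) ⇔ (a1 - a0 ≡ a2 - a1 × a2 - a1 ≡ a3 - a2)))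
theorem4 a0 a1 a2 a3 a0<a1 a1<a2 a2<a3 r0 r1 r2 r3 0<r0 0<r1 0<r2 0<r3 h 2≤h h≤N∸2 = part-i , part-ii
  where
  2≤N : 2 ≤ r0 + r1 + r2 + r3
  2≤N = ℕP.≤-trans (ℕP.+-mono-≤ 0<r0 0<r1) (ℕP.≤-trans (ℕP.m≤m+n _ r2) (ℕP.m≤m+n _ r3))
  open Restricted-sums a0 a1 a2 a3 a0<a1 a1<a2 a2<a3 r0 r1 r2 r3 0<r0 0<r1 0<r2 0<r3 h 2≤h
                       (ℕP.m≤o∸n⇒m+n≤o h 2≤N h≤N∸2)
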